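{- For every pair of integers $m \ge 3$ and $n \ge 3$, we have $\chi'_{st}(C_m \,\square\, P_n) \ge 6$.
   Context: A star edge-coloring of a graph $G$ is a proper edge-coloring of $G$ in which there is no bichromatic path and no bichromatic cycle of length four (i.e., with four edges). The star chromatic index $\chi'_{st}(G)$ is the minimum number of colors in a star edge-coloring of $G$. $C_m$ denotes the cycle on $m$ vertices and $P_n$ the path on $n$ vertices. $G \,\square\, H$ denotes the Cartesian product: vertex set $V(G)\times V(H)$, with $(u,v)(u',v')$ an edge iff either $uu'\in E(G)$ and $v=v'$, or $u=u'$ and $vv'\in E(H)$. -}

module Defs where

open import Data.Nat using (ℕ; suc; _+_; _≤_)
open import Data.Fin using (Fin; toℕ)
open import Data.Product using (_×_; ∃-syntax)
open import Data.Sum using (_⊎_)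
open import Relation.Binary.PropositionalEquality using (_≡_; _≢_)

record Graph : Set₁ where
  field
    V   : Set
    Adj : V → V → Set
open Graph public

Cycle : ℕ → Graph
Cycle m = record
  { V   = Fin m
  ; Adj = λ i j → (suc (toℕ i) ≡ toℕ j) ⊎ (suc (toℕ j) ≡ toℕ i)
                ⊎ ((toℕ i ≡ 0) × (suc (toℕ j) ≡ m))
                ⊎ ((toℕ j ≡ 0) × (suc (toℕ i) ≡ m))
  }

Path : ℕ → Graph
Path n = record
  { V   = Fin n
  ; Adj = λ i j → (suc (toℕ i) ≡ toℕ j) ⊎ (suc (toℕ j) ≡ toℕ i)
  }

_□_ : Graph → Graph → Graph
G □ H = record
  { V   = V G × V H
  ; Adj = λ { (u , v) (u' , v') →
              (Adj G u u' × v ≡ v') ⊎ (u ≡ u' × Adj H v v') }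
  }
  where open import Data.Product using (_,_)

-- An edge-colouring with k colours: a colour for each (ordered) pair of
-- vertices, only meaningful on edges, and required symmetric on edges.
EdgeColouring : Graph → ℕ → Set
EdgeColouring G k = V G → V G → Fin k

module _ (G : Graph) {k : ℕ} (c : EdgeColouring G k) where

  Symmetric : Set
  Symmetric = ∀ u v → Adj G u v → c u v ≡ c v u

  Proper : Set
  Proper = ∀ u v w → Adj G u v → Adj G u w → v ≢ w → c u v ≢ c u w

  InPair : Fin k → Fin k → Fin k → Set
  InPair a b x = (x ≡ a) ⊎ (x ≡ b)

  BichromaticP4 : Set
  BichromaticP4 =
    ∃[ v0 ] ∃[ v1 ] ∃[ v2 ] ∃[ v3 ] ∃[ v4 ] ∃[ a ] ∃[ b ]
      ( v0 ≢ v1 × v0 ≢ v2 × v0 ≢ v3 × v0 ≢ v4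
      × v1 ≢ v2 × v1 ≢ v3 × v1 ≢ v4
      × v2 ≢ v3 × v2 ≢ v4
      × v3 ≢ v4 )
      × Adj G v0 v1 × Adj G v1 v2 × Adj G v2 v3 × Adj G v3 v4
      × InPair a b (c v0 v1) × InPair a b (c v1 v2)
      × InPair a b (c v2 v3) × InPair a b (c v3 v4)

  BichromaticC4 : Set
  BichromaticC4 =
    ∃[ v0 ] ∃[ v1 ] ∃[ v2 ] ∃[ v3 ] ∃[ a ] ∃[ b ]
      ( v0 ≢ v1 × v0 ≢ v2 × v0 ≢ v3
      × v1 ≢ v2 × v1 ≢ v3
      × v2 ≢ v3 )
      × Adj G v0 v1 × Adj G v1 v2 × Adj G v2 v3 × Adj G v3 v0
      × InPair a b (c v0 v1) × InPair a b (c v1 v2)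
      × InPair a b (c v2 v3) × InPair a b (c v3 v0)

  IsStarEdgeColouring : Set
  IsStarEdgeColouring =
    Symmetric × Proper × (BichromaticP4 → ⊥') × (BichromaticC4 → ⊥')
    where open import Data.Empty renaming (⊥ to ⊥')

-- Star edge-colourings restrict to subgraphs and survive an injective renaming of the
-- colours. So it suffices to find in C_m □ P_n a subgraph W with no star edge-colouring
-- by 5 colours: W = C₃ □ P₃ or C₄ □ P₃ when m = 3 or 4, and the grid P₅ □ P₃ when m ≥ 5.
-- For these three graphs this is a finite check, done by a backtracking search that the
-- type checker evaluates. Permuting colours, the four edges at a vertex of degree 4 may
-- be assumed to have colours 0, 1, 2, 3; the remaining edges are coloured one at a time,
-- and a branch dies as soon as it contains two equally coloured edges at a vertex or a
-- bichromatic path or cycle with four edges.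

module Submission where

open import Defs
open import Data.Bool using (Bool; true; false; T; _∨_; if_then_else_)
open import Data.Bool.ListAction using (any; all)
open import Data.Bool.Properties using (T-∨)
open import Data.Empty using (⊥; ⊥-elim)
open import Data.Fin using (Fin; toℕ; inject≤)
open import Data.Fin.Patterns using (0F; 1F; 2F; 3F; 4F)
open import Data.Fin.Permutation.Components using (transpose; transpose-inverse)
open import Data.Fin.Properties using (_≟_; toℕ-inject≤; inject≤-injective)
open import Data.List using (List; []; _∷_; [_]; _++_; map; allFin; filter; filterᵇ; foldr; length)
open import Data.List.Effectful using (monad)
open import Data.List.Membership.Propositional.Properties using (∈-allFin)
open import Data.List.Relation.Unary.All as All using (All; []; _∷_)
open import Data.List.Relation.Unary.All.Properties using (all⁺; all-filter; filter⁺; map⁺)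
open import Data.List.Relation.Unary.AllPairs using (AllPairs; []; _∷_)
open import Data.List.Relation.Unary.Any.Properties using (any⁻; map⁻)
open import Data.Maybe using (Maybe; just; nothing)
import Data.Maybe as Maybe
open import Data.Maybe.Properties using (just-injective)
open import Data.Nat as ℕ using (ℕ; zero; suc; _≤_; _⊔_; _≡ᵇ_; s≤s)
open import Data.Nat.Properties using (≰⇒>; m≤m+n)
open import Data.Product using (∃-syntax; _×_; _,_; proj₁; proj₂; swap)
open import Data.Product.Properties using (≡-dec)
open import Data.Sum using (_⊎_; inj₁; inj₂)
import Data.Sum as Sum
open import Data.Unit using (tt)
open import Effect.Monad using (RawMonad)
open import Function using (_∘_; id)
open import Function.Bundles using (Equivalence)
open import Function.Definitions using (Injective)
open import Level using (0ℓ)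
open import Relation.Binary.Definitions using (DecidableEquality)
open import Relation.Binary.PropositionalEquality
  using (_≡_; _≢_; refl; sym; trans; cong; cong₂; subst; module ≡-Reasoning)
open import Relation.Nullary using (Dec; yes; no; does; ¬_; ¬?)
open import Relation.Nullary.Decidable
  using (True; ⌊_⌋; _×-dec_; _⊎-dec_; toWitness; dec-true; dec-false)

open RawMonad {f = 0ℓ} monad using (_>>=_)

Undirected : Graph → Set
Undirected G = ∀ {u v} → Adj G u v → Adj G v u

DecidableAdj : Graph → Set
DecidableAdj G = ∀ u v → Dec (Adj G u v)

Cycle-undirected : ∀ {m} → Undirected (Cycle m)
Cycle-undirected (inj₁ i→j)                = inj₂ (inj₁ i→j)
Cycle-undirected (inj₂ (inj₁ j→i))         = inj₁ j→i
Cycle-undirected (inj₂ (inj₂ (inj₁ wrap))) = inj₂ (inj₂ (inj₂ wrap))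
Cycle-undirected (inj₂ (inj₂ (inj₂ wrap))) = inj₂ (inj₂ (inj₁ wrap))

Path-undirected : ∀ {n} → Undirected (Path n)
Path-undirected = Sum.swap

□-undirected : ∀ {G H} → Undirected G → Undirected H → Undirected (G □ H)
□-undirected G-und H-und {_ , _} {_ , _} (inj₁ (uu′ , refl)) = inj₁ (G-und uu′ , refl)
□-undirected G-und H-und {_ , _} {_ , _} (inj₂ (refl , vv′)) = inj₂ (refl , H-und vv′)

Cycle-adj? : ∀ {m} → DecidableAdj (Cycle m)
Cycle-adj? {m} i j =
  (suc (toℕ i) ℕ.≟ toℕ j) ⊎-dec (suc (toℕ j) ℕ.≟ toℕ i)
  ⊎-dec ((toℕ i ℕ.≟ 0) ×-dec (suc (toℕ j) ℕ.≟ m))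
  ⊎-dec ((toℕ j ℕ.≟ 0) ×-dec (suc (toℕ i) ℕ.≟ m))

Path-adj? : ∀ {n} → DecidableAdj (Path n)
Path-adj? i j = (suc (toℕ i) ℕ.≟ toℕ j) ⊎-dec (suc (toℕ j) ℕ.≟ toℕ i)

□-adj? : ∀ {G H} → DecidableEquality (V G) → DecidableEquality (V H) →
         DecidableAdj G → DecidableAdj H → DecidableAdj (G □ H)
□-adj? _≟G_ _≟H_ G-adj? H-adj? (u , v) (u′ , v′) =
  (G-adj? u u′ ×-dec v ≟H v′) ⊎-dec (u ≟G u′ ×-dec H-adj? v v′)

record _↪_ (H G : Graph) : Set where
  field
    embed           : V H → V G
    embed-injective : Injective _≡_ _≡_ embed
    embed-adj       : ∀ {u v} → Adj H u v → Adj G (embed u) (embed v)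

open _↪_

↪-refl : ∀ {G} → G ↪ G
↪-refl = record { embed = id ; embed-injective = id ; embed-adj = id }

_□↪_ : ∀ {G G′ H H′} → G ↪ G′ → H ↪ H′ → (G □ H) ↪ (G′ □ H′)
f □↪ g = record
  { embed           = λ (u , v) → embed f u , embed g v
  ; embed-injective = λ {(u , v)} {(u′ , v′)} eq →
      cong₂ _,_ (embed-injective f (cong proj₁ eq)) (embed-injective g (cong proj₂ eq))
  ; embed-adj       = λ { {_ , _} {_ , _} (inj₁ (uu′ , refl)) → inj₁ (embed-adj f uu′ , refl)
                        ; {_ , _} {_ , _} (inj₂ (refl , vv′)) → inj₂ (refl , embed-adj g vv′) }
  }

module _ {n n′ : ℕ} (n≤n′ : n ≤ n′) where

  private
    inject-suc : ∀ {i j : Fin n} → suc (toℕ i) ≡ toℕ j →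
                 suc (toℕ (inject≤ i n≤n′)) ≡ toℕ (inject≤ j n≤n′)
    inject-suc {i} {j} eq =
      trans (cong suc (toℕ-inject≤ i n≤n′)) (trans eq (sym (toℕ-inject≤ j n≤n′)))

    inject-injective : Injective _≡_ _≡_ (λ (i : Fin n) → inject≤ i n≤n′)
    inject-injective = inject≤-injective n≤n′ n≤n′ _ _

  Path↪Path : Path n ↪ Path n′
  Path↪Path = record
    { embed = λ i → inject≤ i n≤n′
    ; embed-injective = inject-injective
    ; embed-adj = Sum.map inject-suc inject-suc
    }

  Path↪Cycle : Path n ↪ Cycle n′
  Path↪Cycle = record
    { embed = λ i → inject≤ i n≤n′
    ; embed-injective = inject-injective
    ; embed-adj = Sum.map inject-suc (inj₁ ∘ inject-suc)
    }

module _ {H G : Graph} {k : ℕ} (f : H ↪ G) where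

  restrict : EdgeColouring G k → EdgeColouring H k
  restrict c u v = c (embed f u) (embed f v)

  isStar-restrict : ∀ {c} → IsStarEdgeColouring G c → IsStarEdgeColouring H (restrict c)
  isStar-restrict {c} (csym , proper , noP4 , noC4) =
    (λ u v uv → csym _ _ (adj uv)) ,
    (λ u v w uv uw v≢w → proper _ _ _ (adj uv) (adj uw) (apart v≢w)) ,
    (λ (v₀ , v₁ , v₂ , v₃ , v₄ , a , b ,
        (d₀₁ , d₀₂ , d₀₃ , d₀₄ , d₁₂ , d₁₃ , d₁₄ , d₂₃ , d₂₄ , d₃₄) ,
        a₀₁ , a₁₂ , a₂₃ , a₃₄ , colours) →
       noP4 (embed f v₀ , embed f v₁ , embed f v₂ , embed f v₃ , embed f v₄ , a , b ,
             (apart d₀₁ , apart d₀₂ , apart d₀₃ , apart d₀₄ , apart d₁₂ ,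
              apart d₁₃ , apart d₁₄ , apart d₂₃ , apart d₂₄ , apart d₃₄) ,
             adj a₀₁ , adj a₁₂ , adj a₂₃ , adj a₃₄ , colours)) ,
    (λ (v₀ , v₁ , v₂ , v₃ , a , b , (d₀₁ , d₀₂ , d₀₃ , d₁₂ , d₁₃ , d₂₃) ,
        a₀₁ , a₁₂ , a₂₃ , a₃₀ , colours) →
       noC4 (embed f v₀ , embed f v₁ , embed f v₂ , embed f v₃ , a , b ,
             (apart d₀₁ , apart d₀₂ , apart d₀₃ , apart d₁₂ , apart d₁₃ , apart d₂₃) ,
             adj a₀₁ , adj a₁₂ , adj a₂₃ , adj a₃₀ , colours))
    where
      adj = embed-adj f
      apart : ∀ {u v} → u ≢ v → embed f u ≢ embed f v
      apart u≢v = u≢v ∘ embed-injective f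

pair-preimage : ∀ {A B : Set} {ι : A → B} → Injective _≡_ _≡_ ι →
                ∀ {x y z a b} → x ≢ y →
                ι x ≡ a ⊎ ι x ≡ b → ι y ≡ a ⊎ ι y ≡ b → ι z ≡ a ⊎ ι z ≡ b → z ≡ x ⊎ z ≡ y
pair-preimage inj x≢y (inj₁ p) (inj₁ q) _        = ⊥-elim (x≢y (inj (trans p (sym q))))
pair-preimage inj x≢y (inj₂ p) (inj₂ q) _        = ⊥-elim (x≢y (inj (trans p (sym q))))
pair-preimage inj _   (inj₁ p) (inj₂ q) (inj₁ r) = inj₁ (inj (trans r (sym p)))
pair-preimage inj _   (inj₁ p) (inj₂ q) (inj₂ r) = inj₂ (inj (trans r (sym q)))
pair-preimage inj _   (inj₂ p) (inj₁ q) (inj₁ r) = inj₂ (inj (trans r (sym q)))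
pair-preimage inj _   (inj₂ p) (inj₁ q) (inj₂ r) = inj₁ (inj (trans r (sym p)))

recolour : ∀ {G k k′} → (Fin k → Fin k′) → EdgeColouring G k → EdgeColouring G k′
recolour ι c u v = ι (c u v)

module _ {G : Graph} (undirected : Undirected G) {k k′ : ℕ} {ι : Fin k → Fin k′}
         (ι-injective : Injective _≡_ _≡_ ι) where

  isStar-recolour : ∀ {c} → IsStarEdgeColouring G c → IsStarEdgeColouring G (recolour {G} ι c)
  isStar-recolour {c} (csym , proper , noP4 , noC4) =
    (λ u v uv → cong ι (csym u v uv)) ,
    (λ u v w uv uw v≢w → proper u v w uv uw v≢w ∘ ι-injective) ,
    (λ (v₀ , v₁ , v₂ , v₃ , v₄ , a , b , distinct@(_ , d₀₂ , _) ,
        a₀₁ , a₁₂ , a₂₃ , a₃₄ , i₀₁ , i₁₂ , i₂₃ , i₃₄) →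
       noP4 (v₀ , v₁ , v₂ , v₃ , v₄ , c v₀ v₁ , c v₁ v₂ , distinct ,
             a₀₁ , a₁₂ , a₂₃ , a₃₄ , inj₁ refl , inj₂ refl ,
             two-coloured a₀₁ a₁₂ d₀₂ i₀₁ i₁₂ i₂₃ , two-coloured a₀₁ a₁₂ d₀₂ i₀₁ i₁₂ i₃₄)) ,
    (λ (v₀ , v₁ , v₂ , v₃ , a , b , distinct@(_ , d₀₂ , _) ,
        a₀₁ , a₁₂ , a₂₃ , a₃₀ , i₀₁ , i₁₂ , i₂₃ , i₃₀) →
       noC4 (v₀ , v₁ , v₂ , v₃ , c v₀ v₁ , c v₁ v₂ , distinct ,
             a₀₁ , a₁₂ , a₂₃ , a₃₀ , inj₁ refl , inj₂ refl ,
             two-coloured a₀₁ a₁₂ d₀₂ i₀₁ i₁₂ i₂₃ , two-coloured a₀₁ a₁₂ d₀₂ i₀₁ i₁₂ i₃₀))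
    where
      -- Properness at v₁ makes the first two colours distinct, so {a , b} is their image.
      two-coloured : ∀ {v₀ v₁ v₂ x a b} → Adj G v₀ v₁ → Adj G v₁ v₂ → v₀ ≢ v₂ →
                     ι (c v₀ v₁) ≡ a ⊎ ι (c v₀ v₁) ≡ b → ι (c v₁ v₂) ≡ a ⊎ ι (c v₁ v₂) ≡ b →
                     ι x ≡ a ⊎ ι x ≡ b → x ≡ c v₀ v₁ ⊎ x ≡ c v₁ v₂
      two-coloured {v₀} {v₁} {v₂} a₀₁ a₁₂ d₀₂ =
        pair-preimage ι-injective
          (λ eq → proper v₁ v₀ v₂ (undirected a₀₁) a₁₂ d₀₂ (trans (sym (csym v₀ v₁ a₀₁)) eq))

module _ {n : ℕ} where

  transpose-sends : ∀ (i j : Fin n) → transpose i j i ≡ j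
  transpose-sends i j rewrite dec-true (i ≟ i) refl = refl

  transpose-fixes : ∀ {i j k : Fin n} → k ≢ i → k ≢ j → transpose i j k ≡ k
  transpose-fixes {i} {j} {k} k≢i k≢j
    rewrite dec-false (k ≟ i) k≢i | dec-false (k ≟ j) k≢j = refl

  transpose-injective : ∀ (i j : Fin n) → Injective _≡_ _≡_ (transpose i j)
  transpose-injective i j {x} {y} eq =
    trans (sym (transpose-inverse j i)) (trans (cong (transpose j i) eq) (transpose-inverse j i))

  relabel : List (Fin n × Fin n) → Fin n → Fin n
  relabel []             = id
  relabel ((a , t) ∷ ps) = transpose (relabel ps a) t ∘ relabel ps

  relabel-injective : ∀ ps → Injective _≡_ _≡_ (relabel ps)
  relabel-injective []             eq = eq
  relabel-injective ((a , t) ∷ ps) eq =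
    relabel-injective ps (transpose-injective (relabel ps a) t eq)

  Apart : Fin n × Fin n → Fin n × Fin n → Set
  Apart (a , t) (a′ , t′) = a ≢ a′ × t ≢ t′

  relabel-sends : ∀ {ps} → AllPairs Apart ps → All (λ (a , t) → relabel ps a ≡ t) ps
  relabel-sends {[]}           []              = []
  relabel-sends {(a , t) ∷ ps} (fresh ∷ apart) =
    transpose-sends (relabel ps a) t ∷ All.zipWith kept (fresh , relabel-sends apart)
    where
      kept : ∀ {p} → Apart (a , t) p × relabel ps (proj₁ p) ≡ proj₂ p →
             relabel ((a , t) ∷ ps) (proj₁ p) ≡ proj₂ p
      kept ((a≢a′ , t≢t′) , sends) rewrite sends =
        transpose-fixes (λ t′≡ → a≢a′ (relabel-injective ps (sym (trans sends t′≡)))) (t≢t′ ∘ sym)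

_‼_ : ∀ {A : Set} → List A → ℕ → Maybe A
[]       ‼ _     = nothing
(x ∷ xs) ‼ zero  = just x
(x ∷ xs) ‼ suc i = xs ‼ i

‼-map : ∀ {A B : Set} (f : A → B) xs i → map f xs ‼ i ≡ Maybe.map f (xs ‼ i)
‼-map f []       i       = refl
‼-map f (x ∷ xs) zero    = refl
‼-map f (x ∷ xs) (suc i) = ‼-map f xs i

_‼?_ : ∀ {A : Set} → List A → Maybe ℕ → Maybe A
xs ‼? i = i Maybe.>>= (xs ‼_)

data Check : Set where
  distinctAt       : Maybe ℕ → Maybe ℕ → Check
  notBichromaticAt : Maybe ℕ → Maybe ℕ → Maybe ℕ → Maybe ℕ → Check

module _ {k : ℕ} where

  monochromatic : Maybe (Fin k) → Maybe (Fin k) → Bool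
  monochromatic (just x) (just y) = ⌊ x ≟ y ⌋
  monochromatic _        _        = false

  bichromatic : Maybe (Fin k) → Maybe (Fin k) → Maybe (Fin k) → Maybe (Fin k) → Bool
  bichromatic (just a) (just b) (just x) (just y) = ⌊ in-pair? x ×-dec in-pair? y ⌋
    where in-pair? = λ z → (z ≟ a) ⊎-dec (z ≟ b)
  bichromatic _ _ _ _ = false

  fails : List (Fin k) → Check → Bool
  fails ρ (distinctAt i j)           = monochromatic (ρ ‼? i) (ρ ‼? j)
  fails ρ (notBichromaticAt i j l m) = bichromatic (ρ ‼? i) (ρ ‼? j) (ρ ‼? l) (ρ ‼? m)

  -- ρ lists the colours of the edges coloured so far, the most recent first, and a
  -- check refers to edges by their position in ρ.
  refutes : List (List Check) → List (Fin k) → Bool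
  refutes []         ρ = false
  refutes (cs ∷ css) ρ = all (λ x → any (fails (x ∷ ρ)) cs ∨ refutes css (x ∷ ρ)) (allFin k)

No5StarColouring : Graph → Set
No5StarColouring G = (c : EdgeColouring G 5) → ¬ IsStarEdgeColouring G c

module Refutation (G : Graph) (_≟ᵥ_ : DecidableEquality (V G)) (adj? : DecidableAdj G) where

  Edge : Set
  Edge = V G × V G

  infix 6 _─_
  _─_ : V G → V G → Edge
  u ─ v = u , v

  SameEdge : Edge → Edge → Set
  SameEdge e e′ = e ≡ e′ ⊎ swap e ≡ e′

  sameEdge? : ∀ e e′ → Dec (SameEdge e e′)
  sameEdge? e e′ = ≡-dec _≟ᵥ_ _≟ᵥ_ e e′ ⊎-dec ≡-dec _≟ᵥ_ _≟ᵥ_ (swap e) e′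

  indexOf : Edge → List Edge → Maybe ℕ
  indexOf e []        = nothing
  indexOf e (e′ ∷ es) with sameEdge? e′ e
  ... | yes _ = just 0
  ... | no _  = Maybe.map suc (indexOf e es)

  indexOf-sound : ∀ e es {i} → indexOf e es ≡ just i → ∃[ e′ ] es ‼ i ≡ just e′ × SameEdge e′ e
  indexOf-sound e (e′ ∷ es) found with sameEdge? e′ e
  ... | yes same rewrite sym (just-injective found) = e′ , refl , same
  ... | no _ with indexOf e es in found′ | found
  ...   | nothing | ()
  ...   | just j  | refl = indexOf-sound e es found′

  data Obstruction : Set where
    fork  : V G → V G → V G → Obstruction
    path  : V G → V G → V G → V G → V G → Obstruction
    cycle : V G → V G → V G → V G → Obstruction

  Valid : Obstruction → Set
  Valid (fork u v w) = Adj G u v × Adj G u w × v ≢ w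
  Valid (path v₀ v₁ v₂ v₃ v₄) =
    ( v₀ ≢ v₁ × v₀ ≢ v₂ × v₀ ≢ v₃ × v₀ ≢ v₄ × v₁ ≢ v₂ × v₁ ≢ v₃ × v₁ ≢ v₄
    × v₂ ≢ v₃ × v₂ ≢ v₄ × v₃ ≢ v₄ )
    × Adj G v₀ v₁ × Adj G v₁ v₂ × Adj G v₂ v₃ × Adj G v₃ v₄
  Valid (cycle v₀ v₁ v₂ v₃) =
    (v₀ ≢ v₁ × v₀ ≢ v₂ × v₀ ≢ v₃ × v₁ ≢ v₂ × v₁ ≢ v₃ × v₂ ≢ v₃)
    × Adj G v₀ v₁ × Adj G v₁ v₂ × Adj G v₂ v₃ × Adj G v₃ v₀

  valid? : ∀ o → Dec (Valid o)
  valid? (fork u v w) = adj? u v ×-dec adj? u w ×-dec ¬? (v ≟ᵥ w)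
  valid? (path v₀ v₁ v₂ v₃ v₄) =
    ( ¬? (v₀ ≟ᵥ v₁) ×-dec ¬? (v₀ ≟ᵥ v₂) ×-dec ¬? (v₀ ≟ᵥ v₃) ×-dec ¬? (v₀ ≟ᵥ v₄)
    ×-dec ¬? (v₁ ≟ᵥ v₂) ×-dec ¬? (v₁ ≟ᵥ v₃) ×-dec ¬? (v₁ ≟ᵥ v₄)
    ×-dec ¬? (v₂ ≟ᵥ v₃) ×-dec ¬? (v₂ ≟ᵥ v₄) ×-dec ¬? (v₃ ≟ᵥ v₄) )
    ×-dec adj? v₀ v₁ ×-dec adj? v₁ v₂ ×-dec adj? v₂ v₃ ×-dec adj? v₃ v₄
  valid? (cycle v₀ v₁ v₂ v₃) =
    ( ¬? (v₀ ≟ᵥ v₁) ×-dec ¬? (v₀ ≟ᵥ v₂) ×-dec ¬? (v₀ ≟ᵥ v₃)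
    ×-dec ¬? (v₁ ≟ᵥ v₂) ×-dec ¬? (v₁ ≟ᵥ v₃) ×-dec ¬? (v₂ ≟ᵥ v₃) )
    ×-dec adj? v₀ v₁ ×-dec adj? v₁ v₂ ×-dec adj? v₂ v₃ ×-dec adj? v₃ v₀

  edgesOf : Obstruction → List Edge
  edgesOf (fork u v w)          = u ─ v ∷ u ─ w ∷ []
  edgesOf (path v₀ v₁ v₂ v₃ v₄) = v₀ ─ v₁ ∷ v₁ ─ v₂ ∷ v₂ ─ v₃ ∷ v₃ ─ v₄ ∷ []
  edgesOf (cycle v₀ v₁ v₂ v₃)   = v₀ ─ v₁ ∷ v₁ ─ v₂ ∷ v₂ ─ v₃ ∷ v₃ ─ v₀ ∷ []

  neighbours : List Edge → V G → List (V G)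
  neighbours es x = es >>= λ (u , v) →
    if does (u ≟ᵥ x) then [ v ] else if does (v ≟ᵥ x) then [ u ] else []

  candidates : List Edge → List Obstruction
  candidates es = forks ++ paths ++ cycles
    where
      arcs = es >>= λ e → e ∷ swap e ∷ []
      forks = do
        (u , v) ← arcs ; w ← neighbours es u
        [ fork u v w ]
      paths = do
        (v₀ , v₁) ← arcs ; v₂ ← neighbours es v₁ ; v₃ ← neighbours es v₂ ; v₄ ← neighbours es v₃
        [ path v₀ v₁ v₂ v₃ v₄ ]
      cycles = do
        (v₀ , v₁) ← arcs ; v₂ ← neighbours es v₁ ; v₃ ← neighbours es v₂
        [ cycle v₀ v₁ v₂ v₃ ]

  locate : List Edge → Obstruction → Check
  locate done (fork u v w) = distinctAt (indexOf (u ─ v) done) (indexOf (u ─ w) done)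
  locate done (path v₀ v₁ v₂ v₃ v₄) =
    notBichromaticAt (indexOf (v₀ ─ v₁) done) (indexOf (v₁ ─ v₂) done)
                     (indexOf (v₂ ─ v₃) done) (indexOf (v₃ ─ v₄) done)
  locate done (cycle v₀ v₁ v₂ v₃) =
    notBichromaticAt (indexOf (v₀ ─ v₁) done) (indexOf (v₁ ─ v₂) done)
                     (indexOf (v₂ ─ v₃) done) (indexOf (v₃ ─ v₀) done)

  completedAt : List Edge → Obstruction → ℕ
  completedAt es o = foldr (λ e m → Maybe.maybe (_⊔ m) 0 (indexOf e es)) 0 (edgesOf o)

  -- Only the speed of the search depends on which checks run at which step: each
  -- obstruction is checked as soon as all its edges are coloured.
  schedule : List (ℕ × Obstruction) → ℕ → List Edge → List Edge → List (List Check)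
  schedule os d done []       = []
  schedule os d done (e ∷ es) =
    map (locate (e ∷ done) ∘ proj₂) (filterᵇ ((_≡ᵇ d) ∘ proj₁) os)
    ∷ schedule os (suc d) (e ∷ done) es

  plan : List Edge → List Edge → List (List Check)
  plan initial rest = schedule timed (length initial) initial rest
    where
      es    = initial ++ rest
      timed = map (λ o → completedAt es o , o) (filter valid? (candidates es))

  Spokes : V G → V G → V G → V G → V G → Set
  Spokes u s₀ s₁ s₂ s₃ =
    (Adj G u s₀ × Adj G u s₁ × Adj G u s₂ × Adj G u s₃)
    × (s₀ ≢ s₁ × s₀ ≢ s₂ × s₀ ≢ s₃ × s₁ ≢ s₂ × s₁ ≢ s₃ × s₂ ≢ s₃)

  spokes? : ∀ u s₀ s₁ s₂ s₃ → Dec (Spokes u s₀ s₁ s₂ s₃)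
  spokes? u s₀ s₁ s₂ s₃ =
    (adj? u s₀ ×-dec adj? u s₁ ×-dec adj? u s₂ ×-dec adj? u s₃)
    ×-dec ( ¬? (s₀ ≟ᵥ s₁) ×-dec ¬? (s₀ ≟ᵥ s₂) ×-dec ¬? (s₀ ≟ᵥ s₃)
          ×-dec ¬? (s₁ ≟ᵥ s₂) ×-dec ¬? (s₁ ≟ᵥ s₃) ×-dec ¬? (s₂ ≟ᵥ s₃) )

  edgeColour : ∀ {k} → EdgeColouring G k → Edge → Fin k
  edgeColour c (u , v) = c u v

  module _ {k : ℕ} {c : EdgeColouring G k} (star : IsStarEdgeColouring G c) where

    open ≡-Reasoning

    private
      csym   = proj₁ star
      proper = proj₁ (proj₂ star)
      noP4   = proj₁ (proj₂ (proj₂ star))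
      noC4   = proj₂ (proj₂ (proj₂ star))

      colourIn : List Edge → Edge → Maybe (Fin k)
      colourIn done e = map (edgeColour c) done ‼? indexOf e done

    sameEdge-colour : ∀ {e u v} → Adj G u v → SameEdge e (u ─ v) → edgeColour c e ≡ c u v
    sameEdge-colour uv (inj₁ refl) = refl
    sameEdge-colour uv (inj₂ refl) = sym (csym _ _ uv)

    colourIn-sound : ∀ done {u v x} → Adj G u v → colourIn done (u ─ v) ≡ just x → c u v ≡ x
    colourIn-sound done {u} {v} {x} uv found with indexOf (u ─ v) done in position | found
    ... | nothing | ()
    ... | just i  | found′ =
      let e , at , same = indexOf-sound (u ─ v) done position
      in trans (sym (sameEdge-colour uv same)) (just-injective (begin
           just (edgeColour c e)               ≡⟨ cong (Maybe.map (edgeColour c)) at ⟨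
           Maybe.map (edgeColour c) (done ‼ i) ≡⟨ ‼-map (edgeColour c) done i ⟨
           map (edgeColour c) done ‼ i         ≡⟨ found′ ⟩
           just x                              ∎))

    monochromatic-sound : ∀ done {u v w} → Adj G u v → Adj G u w →
      T (monochromatic (colourIn done (u ─ v)) (colourIn done (u ─ w))) → c u v ≡ c u w
    monochromatic-sound done {u} {v} {w} uv uw t
      with colourIn done (u ─ v) in found₁ | colourIn done (u ─ w) in found₂
    ... | just x  | just y  =
          trans (colourIn-sound done uv found₁)
                (trans (toWitness {a? = x ≟ y} t) (sym (colourIn-sound done uw found₂)))
    ... | nothing | _       = ⊥-elim t
    ... | just _  | nothing = ⊥-elim t

    bichromatic-sound : ∀ done {u₀ v₀ u₁ v₁ u₂ v₂ u₃ v₃} →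
      Adj G u₀ v₀ → Adj G u₁ v₁ → Adj G u₂ v₂ → Adj G u₃ v₃ →
      T (bichromatic (colourIn done (u₀ ─ v₀)) (colourIn done (u₁ ─ v₁))
                     (colourIn done (u₂ ─ v₂)) (colourIn done (u₃ ─ v₃))) →
      InPair G c (c u₀ v₀) (c u₁ v₁) (c u₂ v₂) × InPair G c (c u₀ v₀) (c u₁ v₁) (c u₃ v₃)
    bichromatic-sound done {u₀} {v₀} {u₁} {v₁} {u₂} {v₂} {u₃} {v₃} a₀ a₁ a₂ a₃ t
      with colourIn done (u₀ ─ v₀) in found₀ | colourIn done (u₁ ─ v₁) in found₁
         | colourIn done (u₂ ─ v₂) in found₂ | colourIn done (u₃ ─ v₃) in found₃
    ... | just a | just b | just x | just y
          rewrite colourIn-sound done a₀ found₀ | colourIn-sound done a₁ found₁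
                | colourIn-sound done a₂ found₂ | colourIn-sound done a₃ found₃ =
          toWitness {a? = ((x ≟ a) ⊎-dec (x ≟ b)) ×-dec ((y ≟ a) ⊎-dec (y ≟ b))} t
    ... | nothing | _       | _       | _       = ⊥-elim t
    ... | just _  | nothing | _       | _       = ⊥-elim t
    ... | just _  | just _  | nothing | _       = ⊥-elim t
    ... | just _  | just _  | just _  | nothing = ⊥-elim t

    excluded : ∀ done o → Valid o → T (fails (map (edgeColour c) done) (locate done o)) → ⊥
    excluded done (fork u v w) (uv , uw , v≢w) t =
      proper u v w uv uw v≢w (monochromatic-sound done uv uw t)
    excluded done (path v₀ v₁ v₂ v₃ v₄) (distinct , a₀₁ , a₁₂ , a₂₃ , a₃₄) t =
      noP4 (v₀ , v₁ , v₂ , v₃ , v₄ , c v₀ v₁ , c v₁ v₂ , distinct , a₀₁ , a₁₂ , a₂₃ , a₃₄ ,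
            inj₁ refl , inj₂ refl , bichromatic-sound done a₀₁ a₁₂ a₂₃ a₃₄ t)
    excluded done (cycle v₀ v₁ v₂ v₃) (distinct , a₀₁ , a₁₂ , a₂₃ , a₃₀) t =
      noC4 (v₀ , v₁ , v₂ , v₃ , c v₀ v₁ , c v₁ v₂ , distinct , a₀₁ , a₁₂ , a₂₃ , a₃₀ ,
            inj₁ refl , inj₂ refl , bichromatic-sound done a₀₁ a₁₂ a₂₃ a₃₀ t)

    refutes-sound : ∀ {os} → All (Valid ∘ proj₂) os → ∀ d done es →
                    T (refutes (schedule os d done es) (map (edgeColour c) done)) → ⊥
    refutes-sound valid d done (e ∷ es) t
      with Equivalence.to T-∨ (All.lookup (all⁺ _ (allFin k) t) (∈-allFin (edgeColour c e)))
    ... | inj₁ found =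
          let o-valid , o-fails = All.lookupAny (filter⁺ _ valid) (map⁻ (any⁻ _ _ found))
          in excluded (e ∷ done) _ o-valid o-fails
    ... | inj₂ deeper = refutes-sound valid (suc d) (e ∷ done) es deeper

  no-5-star-by-search :
    Undirected G → ∀ hub s₀ s₁ s₂ s₃ → True (spokes? hub s₀ s₁ s₂ s₃) → ∀ rest →
    refutes (plan (hub ─ s₀ ∷ hub ─ s₁ ∷ hub ─ s₂ ∷ hub ─ s₃ ∷ []) rest)
            (0F ∷ 1F ∷ 2F ∷ 3F ∷ []) ≡ true →
    No5StarColouring G
  no-5-star-by-search undirected hub s₀ s₁ s₂ s₃ spokes rest certificate c star =
    refutes-sound (isStar-recolour undirected (relabel-injective hubColours) star)
      (map⁺ (all-filter valid? (candidates (initial ++ rest)))) 4 initial rest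
      (subst (T ∘ refutes (plan initial rest)) (sym normalised) (subst T (sym certificate) tt))
    where
      initial = hub ─ s₀ ∷ hub ─ s₁ ∷ hub ─ s₂ ∷ hub ─ s₃ ∷ []
      hubColours = (c hub s₀ , 0F) ∷ (c hub s₁ , 1F) ∷ (c hub s₂ , 2F) ∷ (c hub s₃ , 3F) ∷ []

      apart : Spokes hub s₀ s₁ s₂ s₃ → AllPairs Apart hubColours
      apart ((a₀ , a₁ , a₂ , a₃) , (d₀₁ , d₀₂ , d₀₃ , d₁₂ , d₁₃ , d₂₃)) =
          ((distinct a₀ a₁ d₀₁ , λ ()) ∷ (distinct a₀ a₂ d₀₂ , λ ()) ∷ (distinct a₀ a₃ d₀₃ , λ ()) ∷ [])
        ∷ ((distinct a₁ a₂ d₁₂ , λ ()) ∷ (distinct a₁ a₃ d₁₃ , λ ()) ∷ [])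
        ∷ ((distinct a₂ a₃ d₂₃ , λ ()) ∷ [])
        ∷ [] ∷ []
        where
          distinct : ∀ {v w} → Adj G hub v → Adj G hub w → v ≢ w → c hub v ≢ c hub w
          distinct = proj₁ (proj₂ star) hub _ _

      normalised : map (edgeColour (recolour {G} (relabel hubColours) c)) initial
                   ≡ 0F ∷ 1F ∷ 2F ∷ 3F ∷ []
      normalised with relabel-sends (apart (toWitness spokes))
      ... | e₀ ∷ e₁ ∷ e₂ ∷ e₃ ∷ [] = cong₂ _∷_ e₀ (cong₂ _∷_ e₁ (cong₂ _∷_ e₂ (cong₂ _∷_ e₃ refl)))

Fin²-≟ : ∀ {a b} → DecidableEquality (Fin a × Fin b)
Fin²-≟ = ≡-dec _≟_ _≟_

C₃□P₃-no-5-star : No5StarColouring (Cycle 3 □ Path 3)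
C₃□P₃-no-5-star = no-5-star-by-search (□-undirected Cycle-undirected Path-undirected)
  (1F , 1F) (0F , 1F) (1F , 0F) (1F , 2F) (2F , 1F) _
  ( (0F , 1F) ─ (2F , 1F) ∷ (0F , 0F) ─ (0F , 1F) ∷ (0F , 0F) ─ (1F , 0F) ∷ (0F , 1F) ─ (0F , 2F)
  ∷ (0F , 2F) ─ (1F , 2F) ∷ (1F , 0F) ─ (2F , 0F) ∷ (1F , 2F) ─ (2F , 2F) ∷ (2F , 0F) ─ (2F , 1F)
  ∷ (2F , 1F) ─ (2F , 2F) ∷ (0F , 0F) ─ (2F , 0F) ∷ (0F , 2F) ─ (2F , 2F) ∷ [] )
  refl
  where open Refutation (Cycle 3 □ Path 3) Fin²-≟ (□-adj? _≟_ _≟_ Cycle-adj? Path-adj?)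

C₄□P₃-no-5-star : No5StarColouring (Cycle 4 □ Path 3)
C₄□P₃-no-5-star = no-5-star-by-search (□-undirected Cycle-undirected Path-undirected)
  (2F , 1F) (1F , 1F) (2F , 0F) (2F , 2F) (3F , 1F) _
  ( (0F , 1F) ─ (1F , 1F) ∷ (0F , 1F) ─ (3F , 1F) ∷ (1F , 0F) ─ (1F , 1F) ∷ (1F , 0F) ─ (2F , 0F)
  ∷ (1F , 1F) ─ (1F , 2F) ∷ (1F , 2F) ─ (2F , 2F) ∷ (2F , 0F) ─ (3F , 0F) ∷ (2F , 2F) ─ (3F , 2F)
  ∷ (3F , 0F) ─ (3F , 1F) ∷ (3F , 1F) ─ (3F , 2F) ∷ (0F , 0F) ─ (0F , 1F) ∷ (0F , 0F) ─ (1F , 0F)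
  ∷ (0F , 0F) ─ (3F , 0F) ∷ (0F , 1F) ─ (0F , 2F) ∷ (0F , 2F) ─ (1F , 2F) ∷ (0F , 2F) ─ (3F , 2F)
  ∷ [] )
  refl
  where open Refutation (Cycle 4 □ Path 3) Fin²-≟ (□-adj? _≟_ _≟_ Cycle-adj? Path-adj?)

P₅□P₃-no-5-star : No5StarColouring (Path 5 □ Path 3)
P₅□P₃-no-5-star = no-5-star-by-search (□-undirected Path-undirected Path-undirected)
  (2F , 1F) (1F , 1F) (2F , 0F) (2F , 2F) (3F , 1F) _
  ( (0F , 1F) ─ (1F , 1F) ∷ (1F , 0F) ─ (1F , 1F) ∷ (1F , 0F) ─ (2F , 0F) ∷ (1F , 1F) ─ (1F , 2F)
  ∷ (1F , 2F) ─ (2F , 2F) ∷ (2F , 0F) ─ (3F , 0F) ∷ (2F , 2F) ─ (3F , 2F) ∷ (3F , 0F) ─ (3F , 1F)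
  ∷ (3F , 1F) ─ (3F , 2F) ∷ (3F , 1F) ─ (4F , 1F) ∷ (0F , 0F) ─ (0F , 1F) ∷ (0F , 0F) ─ (1F , 0F)
  ∷ (0F , 1F) ─ (0F , 2F) ∷ (0F , 2F) ─ (1F , 2F) ∷ (3F , 0F) ─ (4F , 0F) ∷ (3F , 2F) ─ (4F , 2F)
  ∷ (4F , 0F) ─ (4F , 1F) ∷ (4F , 1F) ─ (4F , 2F) ∷ [] )
  refl
  where open Refutation (Path 5 □ Path 3) Fin²-≟ (□-adj? _≟_ _≟_ Path-adj? Path-adj?)

record Obstacle (G : Graph) : Set₁ where
  field
    W          : Graph
    undirected : Undirected W
    no-5-star  : No5StarColouring W
    W↪G        : W ↪ G

obstacle-forces-6 : ∀ {G k} {c : EdgeColouring G k} → Obstacle G → IsStarEdgeColouring G c → 6 ≤ k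
obstacle-forces-6 {c = c} obstacle star = ≰⇒> λ k≤5 →
  no-5-star (recolour {W} (λ x → inject≤ x k≤5) (restrict W↪G c))
    (isStar-recolour undirected (inject≤-injective k≤5 k≤5 _ _) (isStar-restrict W↪G star))
  where open Obstacle obstacle

C□P-obstacle : ∀ {m n} → 3 ≤ m → 3 ≤ n → Obstacle (Cycle m □ Path n)
C□P-obstacle {1} (s≤s ())
C□P-obstacle {2} (s≤s (s≤s ()))
C□P-obstacle {3} _ 3≤n = record
  { W = Cycle 3 □ Path 3 ; undirected = □-undirected Cycle-undirected Path-undirected
  ; no-5-star = C₃□P₃-no-5-star ; W↪G = ↪-refl □↪ Path↪Path 3≤n }
C□P-obstacle {4} _ 3≤n = record
  { W = Cycle 4 □ Path 3 ; undirected = □-undirected Cycle-undirected Path-undirected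
  ; no-5-star = C₄□P₃-no-5-star ; W↪G = ↪-refl □↪ Path↪Path 3≤n }
C□P-obstacle {suc (suc (suc (suc (suc m))))} _ 3≤n = record
  { W = Path 5 □ Path 3 ; undirected = □-undirected Path-undirected Path-undirected
  ; no-5-star = P₅□P₃-no-5-star ; W↪G = Path↪Cycle (m≤m+n 5 m) □↪ Path↪Path 3≤n }

corollary10 : (m n : ℕ) → 3 ≤ m → 3 ≤ n →
    (k : ℕ) (c : EdgeColouring (Cycle m □ Path n) k) →
    IsStarEdgeColouring (Cycle m □ Path n) c → 6 ≤ k
corollary10 _ _ 3≤m 3≤n _ _ = obstacle-forces-6 (C□P-obstacle 3≤m 3≤n)
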